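{- Let $p$ be a prime number with $p = 4k+1$ for an integer $k$, and let $d$ be a positive integer. There exist positive integers $u, v$ such that $(du, dv, duv)$ is a solution for $p$ (that is, $\frac{4}{p} = \frac{1}{du} + \frac{1}{dv} + \frac{1}{duv}$ with $du \le dv \le duv$) if and only if there exists a positive integer $n$ such that $$k+1 \equiv 3dn - d \pmod{4dn-1}.$$
   Context: For a positive integer $p$, a solution for $p$ is a triple $(x,y,z)$ of positive integers with $x \le y \le z$ and $\frac{4}{p} = \frac{1}{x} + \frac{1}{y} + \frac{1}{z}$. -}

module Defs where

open import Data.Nat using (ℕ; _+_; _*_; _≤_; _<_)
open import Data.Product using (_×_)
open import Relation.Binary.PropositionalEquality using (_≡_)
open import Data.Integer using (ℤ; +_) renaming (_-_ to _-ℤ_)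
open import Data.Integer.Divisibility using () renaming (_∣_ to _∣ℤ_)

-- (x,y,z) is a solution for p: positive integers, x ≤ y ≤ z, and
-- 4/p = 1/x + 1/y + 1/z, cleared of denominators: 4xyz = p(yz + xz + xy).
IsSolution : ℕ → ℕ → ℕ → ℕ → Set
IsSolution p x y z =
  (0 < x × 0 < y × 0 < z) × (x ≤ y × y ≤ z) ×
  (4 * x * y * z ≡ p * (y * z + x * z + x * y))

_≡_[modℤ_] : ℤ → ℤ → ℤ → Set
a ≡ b [modℤ m ] = m ∣ℤ (a -ℤ b)

{-# OPTIONS --safe #-}
-- Cancelling d²uv, the triple (du, dv, duv) solves 4/p = 1/x + 1/y + 1/z exactly when
-- 4duv = p(u + v + 1) with u ≤ v.  The prime p > 4 then divides u or v: it cannot divide 4,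
-- nor d, since 4cuv > u + v + 1.  Writing that multiple as np and the other entry as w turns
-- the equation into 4dnw = np + w + 1, i.e. w(4dn − 1) = np + 1.  For p = 4k + 1 this gives
-- k + 1 − (3dn − d) = (dw − k − 1)(4dn − 1).  Conversely, if k + 1 − (3dn − d) = t(4dn − 1),
-- then w = 4nt + 3n − 1 solves 4dnw = np + w + 1, and any integer solution w is positive.
module Submission where

open import Defs
open import Data.Nat using (ℕ; zero; suc; _+_; _*_; _≤_; _<_; z≤n; s≤s; NonZero; >-nonZero; >-nonZero⁻¹; _≤?_)
open import Data.Nat.Properties
open import Data.Nat.Divisibility using (_∣_; divides; ∣⇒≤)
open import Data.Nat.Primality using (Prime; euclidsLemma; prime⇒nonZero; ¬prime[1])
open import Data.Nat.Tactic.RingSolver using (solve)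
open import Data.Integer using (ℤ; +_; -[1+_]; -_) renaming (_+_ to _+ℤ_; _-_ to _-ℤ_; _*_ to _*ℤ_)
open import Data.Integer.Properties using (pos-*; +-injective)
import Data.Integer.Divisibility.Signed as ℤ∣
import Data.Integer.Tactic.RingSolver as ℤRing
open import Data.List using ([]; _∷_)
open import Data.Product using (_×_; _,_; ∃-syntax)
open import Data.Sum using (_⊎_; inj₁; inj₂)
open import Data.Empty using (⊥-elim)
open import Function.Bundles using (_⇔_; mk⇔; Equivalence)
open Equivalence using (to; from)
open import Relation.Nullary using (yes; no)
open import Relation.Binary.PropositionalEquality using (_≡_; _≢_; refl; sym; trans; cong; cong₂; module ≡-Reasoning)
open ≡-Reasoning

isSolution-scaled⇔ : ∀ p {d u v} → 0 < d → 0 < u → 0 < v →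
  IsSolution p (d * u) (d * v) (d * u * v) ⇔ (u ≤ v × 4 * d * u * v ≡ p * (u + v + 1))
isSolution-scaled⇔ p {d} {u} {v} 0<d 0<u 0<v = mk⇔ reduce scale
  where
  instance
    _ = >-nonZero 0<d
    _ = >-nonZero 0<u
    _ = >-nonZero 0<v
    _ = m*n≢0 d u
    _ = m*n≢0 d v
    _ = m*n≢0 (d * u) v
    _ = m*n≢0 d d
    _ = m*n≢0 (d * d) u
    _ = m*n≢0 (d * d * u) v

  lhs-factor : 4 * (d * u) * (d * v) * (d * u * v) ≡ (d * d * u * v) * (4 * d * u * v)
  lhs-factor = solve (d ∷ u ∷ v ∷ [])
  rhs-factor : p * ((d * v) * (d * u * v) + (d * u) * (d * u * v) + (d * u) * (d * v))
               ≡ (d * d * u * v) * (p * (u + v + 1))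
  rhs-factor = solve (p ∷ d ∷ u ∷ v ∷ [])

  reduce : IsSolution p (d * u) (d * v) (d * u * v) → u ≤ v × 4 * d * u * v ≡ p * (u + v + 1)
  reduce (_ , (du≤dv , _) , eq) =
    *-cancelˡ-≤ d du≤dv ,
    *-cancelˡ-≡ _ _ (d * d * u * v) (trans (sym lhs-factor) (trans eq rhs-factor))

  scale : u ≤ v × 4 * d * u * v ≡ p * (u + v + 1) → IsSolution p (d * u) (d * v) (d * u * v)
  scale (u≤v , eq) =
    (>-nonZero⁻¹ (d * u) , >-nonZero⁻¹ (d * v) , >-nonZero⁻¹ (d * u * v)) ,
    (*-monoʳ-≤ d u≤v , *-monoˡ-≤ v (m≤m*n d u)) ,
    trans lhs-factor (trans (cong (d * d * u * v *_) eq) (sym rhs-factor))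

4*c*u*v≢u+v+1 : ∀ {c u v} → 0 < c → 0 < u → 0 < v → 4 * c * u * v ≢ u + v + 1
4*c*u*v≢u+v+1 {suc c} {suc u} {suc v} _ _ _ eq = m+1+n≢m (suc u + suc v + 1) (trans excess eq)
  where
  excess : suc u + suc v + 1 + suc (4 * c * u * v + 4 * c * u + 4 * c * v + 4 * c + 4 * u * v + 3 * u + 3 * v)
           ≡ 4 * suc c * suc u * suc v
  excess = solve (c ∷ u ∷ v ∷ [])

0<m*n⇒0<m : ∀ m {n} → 0 < m * n → 0 < m
0<m*n⇒0<m m 0<mn = >-nonZero⁻¹ m {{m*n≢0⇒m≢0 m {{>-nonZero 0<mn}}}}

prime∣u⊎prime∣v : ∀ {p d u v} → Prime p → 4 < p → 0 < d → 0 < u → 0 < v →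
  4 * d * u * v ≡ p * (u + v + 1) → p ∣ u ⊎ p ∣ v
prime∣u⊎prime∣v {p} {d} {u} {v} pr 4<p 0<d 0<u 0<v eq
  with euclidsLemma (4 * d * u) v pr (divides (u + v + 1) (trans eq (*-comm p _)))
... | inj₂ p∣v = inj₂ p∣v
... | inj₁ p∣4du with euclidsLemma (4 * d) u pr p∣4du
...   | inj₂ p∣u = inj₁ p∣u
...   | inj₁ p∣4d with euclidsLemma 4 d pr p∣4d
...     | inj₁ p∣4 = ⊥-elim (<⇒≱ 4<p (∣⇒≤ p∣4))
...     | inj₂ (divides c refl) =
  ⊥-elim (4*c*u*v≢u+v+1 (0<m*n⇒0<m c 0<d) 0<u 0<v (*-cancelˡ-≡ _ _ p {{prime⇒nonZero pr}} pull-p))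
  where
  pull-p : p * (4 * c * u * v) ≡ p * (u + v + 1)
  pull-p = begin
    p * (4 * c * u * v)  ≡⟨ solve (p ∷ c ∷ u ∷ v ∷ []) ⟩
    4 * (c * p) * u * v  ≡⟨ eq ⟩
    p * (u + v + 1)      ∎

reducedEquation-swap : ∀ p d u v → 4 * d * u * v ≡ p * (u + v + 1) → 4 * d * v * u ≡ p * (v + u + 1)
reducedEquation-swap p d u v eq = begin
  4 * d * v * u    ≡⟨ solve (d ∷ u ∷ v ∷ []) ⟩
  4 * d * u * v    ≡⟨ eq ⟩
  p * (u + v + 1)  ≡⟨ solve (p ∷ u ∷ v ∷ []) ⟩
  p * (v + u + 1)  ∎

reducedEquation-multiple⇔ : ∀ p d n w .{{_ : NonZero p}} →
  4 * d * (n * p) * w ≡ p * (n * p + w + 1) ⇔ 4 * d * n * w ≡ n * p + w + 1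
reducedEquation-multiple⇔ p d n w = mk⇔
  (λ eq → *-cancelˡ-≡ _ _ p (trans pull-p eq))
  (λ eq → trans (sym pull-p) (cong (p *_) eq))
  where
  pull-p : p * (4 * d * n * w) ≡ 4 * d * (n * p) * w
  pull-p = solve (p ∷ d ∷ n ∷ w ∷ [])

keyEquation⇒0<w : ∀ p d n w → 4 * d * n * w ≡ n * p + w + 1 → 0 < w
keyEquation⇒0<w p d n zero    eq = ⊥-elim (m+1+n≢0 (n * p + 0) (trans (sym eq) (*-zeroʳ (4 * d * n))))
keyEquation⇒0<w _ _ _ (suc _) _ = s≤s z≤n

reducedEquation⇒scaledSolution : ∀ p d u v → 0 < d → 0 < u → 0 < v → 4 * d * u * v ≡ p * (u + v + 1) →
  ∃[ u′ ] ∃[ v′ ] (0 < u′ × 0 < v′ × IsSolution p (d * u′) (d * v′) (d * u′ * v′))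
reducedEquation⇒scaledSolution p d u v 0<d 0<u 0<v eq with u ≤? v
... | yes u≤v = u , v , 0<u , 0<v , from (isSolution-scaled⇔ p 0<d 0<u 0<v) (u≤v , eq)
... | no u≰v = v , u , 0<v , 0<u ,
  from (isSolution-scaled⇔ p 0<d 0<v 0<u) (<⇒≤ (≰⇒> u≰v) , reducedEquation-swap p d u v eq)

scaledSolution⇔keyEquation : ∀ {p d} → Prime p → 4 < p → 0 < d →
  (∃[ u ] ∃[ v ] (0 < u × 0 < v × IsSolution p (d * u) (d * v) (d * u * v)))
    ⇔ (∃[ n ] (0 < n × ∃[ w ] 4 * d * n * w ≡ n * p + w + 1))
scaledSolution⇔keyEquation {p} {d} pr 4<p 0<d = mk⇔ solution⇒key key⇒solution
  where
  instance _ = prime⇒nonZero pr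

  fromMultiple : ∀ {u v} → 0 < u → p ∣ u → 4 * d * u * v ≡ p * (u + v + 1) →
    ∃[ n ] (0 < n × ∃[ w ] 4 * d * n * w ≡ n * p + w + 1)
  fromMultiple 0<u (divides n refl) eq = n , 0<m*n⇒0<m n 0<u , _ , to (reducedEquation-multiple⇔ p d n _) eq

  solution⇒key : (∃[ u ] ∃[ v ] (0 < u × 0 < v × IsSolution p (d * u) (d * v) (d * u * v))) →
    ∃[ n ] (0 < n × ∃[ w ] 4 * d * n * w ≡ n * p + w + 1)
  solution⇒key (u , v , 0<u , 0<v , sol) with to (isSolution-scaled⇔ p 0<d 0<u 0<v) sol
  ... | _ , eq with prime∣u⊎prime∣v pr 4<p 0<d 0<u 0<v eq
  ...   | inj₁ p∣u = fromMultiple 0<u p∣u eq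
  ...   | inj₂ p∣v = fromMultiple 0<v p∣v (reducedEquation-swap p d u v eq)

  key⇒solution : (∃[ n ] (0 < n × ∃[ w ] 4 * d * n * w ≡ n * p + w + 1)) →
    ∃[ u ] ∃[ v ] (0 < u × 0 < v × IsSolution p (d * u) (d * v) (d * u * v))
  key⇒solution (n , 0<n , w , eq) =
    reducedEquation⇒scaledSolution p d (n * p) w 0<d (>-nonZero⁻¹ (n * p) {{m*n≢0 n p {{>-nonZero 0<n}}}})
      (keyEquation⇒0<w p d n w eq) (from (reducedEquation-multiple⇔ p d n w) eq)

4<4k+1 : ∀ k → Prime (4 * k + 1) → 4 < 4 * k + 1
4<4k+1 zero    pr = ⊥-elim (¬prime[1] pr)
4<4k+1 (suc k) _  = ≤-trans (m≤m+n 5 (4 * k)) (≤-reflexive regroup)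
  where
  regroup : 5 + 4 * k ≡ 4 * suc k + 1
  regroup = solve (k ∷ [])

pos-4*d*n*w : ∀ d n w → + (4 * d * n * w) ≡ + 4 *ℤ + d *ℤ + n *ℤ + w
pos-4*d*n*w d n w = begin
  + (4 * d * n * w)                ≡⟨ pos-* (4 * d * n) w ⟩
  + (4 * d * n) *ℤ + w             ≡⟨ cong (_*ℤ + w) (pos-* (4 * d) n) ⟩
  + (4 * d) *ℤ + n *ℤ + w          ≡⟨ cong (λ x → x *ℤ + n *ℤ + w) (pos-* 4 d) ⟩
  + 4 *ℤ + d *ℤ + n *ℤ + w         ∎

pos-n*[4k+1] : ∀ k n → + (n * (4 * k + 1)) ≡ + n *ℤ (+ 4 *ℤ + k +ℤ + 1)
pos-n*[4k+1] k n = trans (pos-* n (4 * k + 1)) (cong (λ x → + n *ℤ (x +ℤ + 1)) (pos-* 4 k))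

keyEquation-ℕ⇔ℤ : ∀ k d n w →
  4 * d * n * w ≡ n * (4 * k + 1) + w + 1
    ⇔ + 4 *ℤ + d *ℤ + n *ℤ + w ≡ + n *ℤ (+ 4 *ℤ + k +ℤ + 1) +ℤ + w +ℤ + 1
keyEquation-ℕ⇔ℤ k d n w = mk⇔
  (λ eq → trans (sym (pos-4*d*n*w d n w)) (trans (cong +_ eq) rhs-cast))
  (λ eq → +-injective (trans (pos-4*d*n*w d n w) (trans eq (sym rhs-cast))))
  where
  rhs-cast : + (n * (4 * k + 1) + w + 1) ≡ + n *ℤ (+ 4 *ℤ + k +ℤ + 1) +ℤ + w +ℤ + 1
  rhs-cast = cong (λ x → x +ℤ + w +ℤ + 1) (pos-n*[4k+1] k n)

module _ (k d n : ℤ) where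
  keyEquationℤ⇒congruence : ∀ w → + 4 *ℤ d *ℤ n *ℤ w ≡ n *ℤ (+ 4 *ℤ k +ℤ + 1) +ℤ w +ℤ + 1 →
    (k +ℤ + 1) -ℤ (+ 3 *ℤ d *ℤ n -ℤ d) ≡ (d *ℤ w -ℤ (k +ℤ + 1)) *ℤ (+ 4 *ℤ d *ℤ n -ℤ + 1)
  keyEquationℤ⇒congruence w eq = begin
    (k +ℤ + 1) -ℤ (+ 3 *ℤ d *ℤ n -ℤ d)
      ≡⟨ ℤRing.solve (k ∷ d ∷ n ∷ w ∷ []) ⟩
    (d *ℤ w -ℤ (k +ℤ + 1)) *ℤ (+ 4 *ℤ d *ℤ n -ℤ + 1)
      +ℤ d *ℤ (n *ℤ (+ 4 *ℤ k +ℤ + 1) +ℤ w +ℤ + 1) -ℤ d *ℤ (+ 4 *ℤ d *ℤ n *ℤ w)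
      ≡⟨ cong (λ x → (d *ℤ w -ℤ (k +ℤ + 1)) *ℤ (+ 4 *ℤ d *ℤ n -ℤ + 1)
                       +ℤ d *ℤ x -ℤ d *ℤ (+ 4 *ℤ d *ℤ n *ℤ w)) (sym eq) ⟩
    (d *ℤ w -ℤ (k +ℤ + 1)) *ℤ (+ 4 *ℤ d *ℤ n -ℤ + 1)
      +ℤ d *ℤ (+ 4 *ℤ d *ℤ n *ℤ w) -ℤ d *ℤ (+ 4 *ℤ d *ℤ n *ℤ w)
      ≡⟨ ℤRing.solve (k ∷ d ∷ n ∷ w ∷ []) ⟩
    (d *ℤ w -ℤ (k +ℤ + 1)) *ℤ (+ 4 *ℤ d *ℤ n -ℤ + 1) ∎

  congruence⇒keyEquationℤ : ∀ t →
    (k +ℤ + 1) -ℤ (+ 3 *ℤ d *ℤ n -ℤ d) ≡ t *ℤ (+ 4 *ℤ d *ℤ n -ℤ + 1) →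
    + 4 *ℤ d *ℤ n *ℤ (+ 4 *ℤ n *ℤ t +ℤ + 3 *ℤ n -ℤ + 1)
      ≡ n *ℤ (+ 4 *ℤ k +ℤ + 1) +ℤ (+ 4 *ℤ n *ℤ t +ℤ + 3 *ℤ n -ℤ + 1) +ℤ + 1
  congruence⇒keyEquationℤ t eq = begin
    + 4 *ℤ d *ℤ n *ℤ (+ 4 *ℤ n *ℤ t +ℤ + 3 *ℤ n -ℤ + 1)
      ≡⟨ ℤRing.solve (k ∷ d ∷ n ∷ t ∷ []) ⟩
    + 4 *ℤ n *ℤ (t *ℤ (+ 4 *ℤ d *ℤ n -ℤ + 1) +ℤ t +ℤ + 3 *ℤ d *ℤ n -ℤ d)
      ≡⟨ cong (λ x → + 4 *ℤ n *ℤ (x +ℤ t +ℤ + 3 *ℤ d *ℤ n -ℤ d)) (sym eq) ⟩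
    + 4 *ℤ n *ℤ ((k +ℤ + 1) -ℤ (+ 3 *ℤ d *ℤ n -ℤ d) +ℤ t +ℤ + 3 *ℤ d *ℤ n -ℤ d)
      ≡⟨ ℤRing.solve (k ∷ d ∷ n ∷ t ∷ []) ⟩
    n *ℤ (+ 4 *ℤ k +ℤ + 1) +ℤ (+ 4 *ℤ n *ℤ t +ℤ + 3 *ℤ n -ℤ + 1) +ℤ + 1 ∎

  keyEquationℤ-negate : ∀ w → + 4 *ℤ d *ℤ n *ℤ w ≡ n *ℤ (+ 4 *ℤ k +ℤ + 1) +ℤ w +ℤ + 1 →
    + 4 *ℤ d *ℤ n *ℤ (- w) +ℤ n *ℤ (+ 4 *ℤ k +ℤ + 1) +ℤ + 1 ≡ - w
  keyEquationℤ-negate w eq = begin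
    + 4 *ℤ d *ℤ n *ℤ (- w) +ℤ n *ℤ (+ 4 *ℤ k +ℤ + 1) +ℤ + 1
      ≡⟨ ℤRing.solve (k ∷ d ∷ n ∷ w ∷ []) ⟩
    - (+ 4 *ℤ d *ℤ n *ℤ w) +ℤ n *ℤ (+ 4 *ℤ k +ℤ + 1) +ℤ + 1
      ≡⟨ cong (λ x → - x +ℤ n *ℤ (+ 4 *ℤ k +ℤ + 1) +ℤ + 1) eq ⟩
    - (n *ℤ (+ 4 *ℤ k +ℤ + 1) +ℤ w +ℤ + 1) +ℤ n *ℤ (+ 4 *ℤ k +ℤ + 1) +ℤ + 1
      ≡⟨ ℤRing.solve (k ∷ d ∷ n ∷ w ∷ []) ⟩
    - w ∎

4*d*n*s+n*p+1≢s : ∀ {d n} p s → 0 < d → 0 < n → 4 * d * n * s + n * p + 1 ≢ s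
4*d*n*s+n*p+1≢s {suc d} {suc n} p s _ _ eq = m+1+n≢m s (trans excess eq)
  where
  excess : s + suc (s * (3 + 4 * (d + n + d * n)) + suc n * p) ≡ 4 * suc d * suc n * s + suc n * p + 1
  excess = solve (d ∷ n ∷ p ∷ s ∷ [])

keyEquationℤ⇒keyEquation : ∀ k d n → 0 < d → 0 < n → ∀ w →
  + 4 *ℤ + d *ℤ + n *ℤ w ≡ + n *ℤ (+ 4 *ℤ + k +ℤ + 1) +ℤ w +ℤ + 1 →
  ∃[ w′ ] 4 * d * n * w′ ≡ n * (4 * k + 1) + w′ + 1
keyEquationℤ⇒keyEquation k d n _ _ (+ w) eq = w , from (keyEquation-ℕ⇔ℤ k d n w) eq
keyEquationℤ⇒keyEquation k d n 0<d 0<n -[1+ s ] eq =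
  ⊥-elim (4*d*n*s+n*p+1≢s (4 * k + 1) (suc s) 0<d 0<n
    (+-injective (trans cast (keyEquationℤ-negate (+ k) (+ d) (+ n) -[1+ s ] eq))))
  where
  cast : + (4 * d * n * suc s + n * (4 * k + 1) + 1)
         ≡ + 4 *ℤ + d *ℤ + n *ℤ + suc s +ℤ + n *ℤ (+ 4 *ℤ + k +ℤ + 1) +ℤ + 1
  cast = cong₂ (λ x y → x +ℤ y +ℤ + 1) (pos-4*d*n*w d n (suc s)) (pos-n*[4k+1] k n)

keyEquation⇔congruence : ∀ k d n → 0 < d → 0 < n →
  (∃[ w ] 4 * d * n * w ≡ n * (4 * k + 1) + w + 1)
    ⇔ (+ (k + 1)) ≡ (+ 3 *ℤ + d *ℤ + n -ℤ + d) [modℤ (+ 4 *ℤ + d *ℤ + n -ℤ + 1) ]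
keyEquation⇔congruence k d n 0<d 0<n = mk⇔
  (λ (w , eq) → ℤ∣.∣⇒∣ᵤ {+ 4 *ℤ + d *ℤ + n -ℤ + 1} (ℤ∣.divides (+ d *ℤ + w -ℤ (+ k +ℤ + 1))
    (keyEquationℤ⇒congruence (+ k) (+ d) (+ n) (+ w) (to (keyEquation-ℕ⇔ℤ k d n w) eq))))
  (λ M∣ → let ℤ∣.divides t eq = ℤ∣.∣ᵤ⇒∣ {+ 4 *ℤ + d *ℤ + n -ℤ + 1} M∣ in
    keyEquationℤ⇒keyEquation k d n 0<d 0<n _ (congruence⇒keyEquationℤ (+ k) (+ d) (+ n) t eq))

mainTheorem2 : (p k d : ℕ) → Prime p → p ≡ 4 * k + 1 → 0 < d →
    (∃[ u ] ∃[ v ] (0 < u × 0 < v × IsSolution p (d * u) (d * v) (d * u * v)))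
      ⇔ (∃[ n ] (0 < n × (+ (k + 1)) ≡ (+ 3 *ℤ + d *ℤ + n -ℤ + d) [modℤ (+ 4 *ℤ + d *ℤ + n -ℤ + 1) ]))
mainTheorem2 p k d pr refl 0<d = mk⇔
  (λ sol → let (n , 0<n , key) = to (scaledSolution⇔keyEquation pr 4<p 0<d) sol
           in n , 0<n , to (keyEquation⇔congruence k d n 0<d 0<n) key)
  (λ (n , 0<n , congruence) → from (scaledSolution⇔keyEquation pr 4<p 0<d)
           (n , 0<n , from (keyEquation⇔congruence k d n 0<d 0<n) congruence))
  where
  4<p : 4 < 4 * k + 1
  4<p = 4<4k+1 k pr
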